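{- Let $(G,\cdot)$ be a finite abelian group of order $n$ and let $\{A_0,\dots,A_{m-1}\}$ (with $l,m\ge 2$) be an $(n,m,l;\lambda)$-$1$-SCEDF in $G$. Then $m=2$.
   Context: For subsets $A,B\subseteq G$, $\Delta(A,B)$ is the multiset $\{\{ab^{ -1}: a\in A, b\in B\}\}$. For $l,m\ge2$ and $c\in\{1,\dots,m-1\}$, a family $\{A_0,\dots,A_{m-1}\}$ of $m$ pairwise disjoint subsets of $G$ is an $(n,m,l;\lambda)$-$c$-strong circular external difference family (SCEDF) in $G$ if $|A_i|=l$ for all $i$ and, for every $0\le i\le m-1$, $A_{i+c}A_i^{(-1)}=\lambda(G-1_G)$ in the group ring $\mathbb{Z}[G]$ (i.e. each $g\ne 1_G$ occurs exactly $\lambda$ times and $1_G$ does not occur in $\Delta(A_{i+c},A_i)$), with subscripts modulo $m$; here $\lambda$ is a positive integer. -}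

module Defs where

open import Level using (Level; _⊔_)
open import Data.Nat using (ℕ; zero; suc; _+_)
open import Data.Nat.DivMod using (_%_; m%n<n)
open import Data.Fin using (Fin; toℕ; fromℕ<)
open import Data.Fin.Subset using (Subset; _∈_; ∣_∣)
open import Data.Fin.Subset.Properties using (_∈?_)
open import Data.Product using (Σ; _×_; _,_)
open import Relation.Nullary using (Dec; yes; no; ¬_)
open import Relation.Nullary.Decidable using (_×-dec_)
open import Relation.Binary.PropositionalEquality using (_≡_)
open import Algebra.Bundles using (AbelianGroup)

sumFin : ∀ {n} → (Fin n → ℕ) → ℕ
sumFin {zero}  f = 0
sumFin {suc n} f = f Fin.zero + sumFin (λ i → f (Fin.suc i))

⟦_⟧ : ∀ {p} {P : Set p} → Dec P → ℕ
⟦ yes _ ⟧ = 1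
⟦ no  _ ⟧ = 0

next : ∀ {m} → Fin m → Fin m
next {suc k} i = fromℕ< (m%n<n (suc (toℕ i)) (suc k))

record FiniteAbelianGroup (c ℓ : Level) (n : ℕ) : Set (Level.suc (c ⊔ ℓ)) where
  field
    abGroup : AbelianGroup c ℓ
  open AbelianGroup abGroup public
  field
    enum      : Fin n → Carrier
    enum-inj  : ∀ i j → enum i ≈ enum j → i ≡ j
    enum-surj : ∀ g → Σ (Fin n) (λ i → enum i ≈ g)
    _≈?_      : ∀ x y → Dec (x ≈ y)

module _ {c ℓ n} (G : FiniteAbelianGroup c ℓ n) where
  open FiniteAbelianGroup G

  -- Multiplicity of g in the multiset Δ(A,B) = {{ a b⁻¹ : a ∈ A, b ∈ B }},
  -- subsets of G being given as subsets of the index set Fin n.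
  Δcount : Subset n → Subset n → Carrier → ℕ
  Δcount A B g =
    sumFin (λ a → sumFin (λ b →
      ⟦ (a ∈? A) ×-dec ((b ∈? B) ×-dec ((enum a ∙ (enum b) ⁻¹) ≈? g)) ⟧))

  record Is1SCEDF (m l lam : ℕ) (A : Fin m → Subset n) : Set (c ⊔ ℓ) where
    field
      λ-pos    : 1 Data.Nat.≤ lam
      size     : ∀ i → ∣ A i ∣ ≡ l
      disjoint : ∀ i j → ¬ (i ≡ j) → ∀ x → x ∈ A i → ¬ (x ∈ A j)
      diff-ne  : ∀ i g → ¬ (g ≈ ε) → Δcount (A (next i)) (A i) g ≡ lam
      diff-one : ∀ i g → g ≈ ε → Δcount (A (next i)) (A i) g ≡ 0

{-# OPTIONS --safe #-}

-- In ℤ[G] the hypothesis reads A_{i+1} A_i⁽⁻¹⁾ = λ(G − 1) for every i. Since G − 1 is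
-- invariant under inversion, P Y⁽⁻¹⁾ = λ(G − 1) = (Y Q⁽⁻¹⁾)⁽⁻¹⁾ = Q Y⁽⁻¹⁾ for
-- P = A_{i+2}, Y = A_{i+1}, Q = A_i. Multiplying by Q and using commutativity gives
-- P · λ(G − 1) = Q · λ(G − 1), that is λ|P|G − λP = λ|Q|G − λQ, so P = Q as |P| = |Q|.
-- Hence A_2 = A_0, which for m ≥ 3 contradicts disjointness, A_0 being nonempty.

module Submission where

open import Defs
open import Level using (Level)
open import Function using (_∘_; _⇔_; mk⇔; Equivalence)
open import Data.Empty using (⊥-elim)
open import Data.Nat using (ℕ; zero; suc; _+_; _*_; _≤_; s≤s; z≤n; NonZero; >-nonZero)
open import Data.Nat.Properties
  using ( +-*-semiring; *-commutativeSemigroup; ≤-trans; *-zeroʳ; *-identityʳ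
        ; *-distribˡ-+; +-identityʳ; +-cancelˡ-≡; *-cancelˡ-≡ )
open import Data.Fin using (Fin; zero; suc; punchIn)
open import Data.Fin.Properties using (punchInᵢ≢i)
open import Data.Fin.Subset using (Subset; _∈_; ∣_∣; inside; outside; Nonempty)
open import Data.Fin.Subset.Properties
  using (_∈?_; drop-there; ⊆-antisym; nonempty?; Empty-unique; ∣⊥∣≡0)
open import Data.Product using (_,_)
open import Data.Vec using (_∷_; []; there)
open import Data.Vec.Functional using (removeAt)
open import Relation.Nullary using (Dec; yes; no; ¬_; ¬?; contradiction)
open import Relation.Nullary.Decidable using (_×-dec_)
open import Relation.Unary using (Decidable)
open import Relation.Binary.PropositionalEquality
  using (_≡_; refl; sym; trans; cong; cong₂; subst; module ≡-Reasoning)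
open import Algebra.Bundles using (Group; AbelianGroup)
import Algebra.Properties.Group as GroupProperties
import Algebra.Properties.CommutativeSemigroup as CommutativeSemigroupProperties
open import Algebra.Properties.Semiring.Sum +-*-semiring
  using (sum; sum-syntax; sum-cong-≗; sum-remove; sum-replicate-zero; ∑-comm; ∑-distrib-+; *-distribˡ-sum)

open CommutativeSemigroupProperties *-commutativeSemigroup using (x∙yz≈y∙xz; x∙yz≈yx∙z)
open Equivalence using (to; from)

private
  variable
    p q : Level
    P : Set p
    Q : Set q

⟦×-dec⟧ : (p? : Dec P) (q? : Dec Q) → ⟦ p? ×-dec q? ⟧ ≡ ⟦ p? ⟧ * ⟦ q? ⟧
⟦×-dec⟧ (yes _) (yes _) = refl
⟦×-dec⟧ (yes _) (no _)  = refl
⟦×-dec⟧ (no _)  _       = refl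

⟦⟧≡1 : (p? : Dec P) → P → ⟦ p? ⟧ ≡ 1
⟦⟧≡1 (yes _) _  = refl
⟦⟧≡1 (no ¬p) p  = contradiction p ¬p

⟦⟧≡0 : (p? : Dec P) → ¬ P → ⟦ p? ⟧ ≡ 0
⟦⟧≡0 (yes p) ¬p = contradiction p ¬p
⟦⟧≡0 (no _)  _  = refl

⟦¬?⟧+⟦⟧≡1 : (p? : Dec P) → ⟦ ¬? p? ⟧ + ⟦ p? ⟧ ≡ 1
⟦¬?⟧+⟦⟧≡1 (yes _) = refl
⟦¬?⟧+⟦⟧≡1 (no _)  = refl

⟦⟧-cong : P ⇔ Q → (p? : Dec P) (q? : Dec Q) → ⟦ p? ⟧ ≡ ⟦ q? ⟧
⟦⟧-cong P⇔Q (yes p) q? = sym (⟦⟧≡1 q? (to P⇔Q p))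
⟦⟧-cong P⇔Q (no ¬p) q? = sym (⟦⟧≡0 q? (¬p ∘ from P⇔Q))

⟦⟧≡⟦⟧⇒ : (p? : Dec P) (q? : Dec Q) → ⟦ p? ⟧ ≡ ⟦ q? ⟧ → P → Q
⟦⟧≡⟦⟧⇒ _       (yes q) _  _ = q
⟦⟧≡⟦⟧⇒ (yes _) (no _)  () _
⟦⟧≡⟦⟧⇒ (no ¬p) (no _)  _  p = contradiction p ¬p

sumFin≡sum : ∀ {n} (f : Fin n → ℕ) → sumFin f ≡ sum f
sumFin≡sum {zero}  f = refl
sumFin≡sum {suc n} f = cong (f zero +_) (sumFin≡sum (f ∘ suc))

∑-single : ∀ {n} {P : Fin n → Set p} (P? : Decidable P) (f : Fin n → ℕ) {x} →
           P x → (∀ {c} → P c → c ≡ x) → ∑[ c < n ] (f c * ⟦ P? c ⟧) ≡ f x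
∑-single {n = suc n} P? f {x} Px unique = begin
  sum t                         ≡⟨ sum-remove {i = x} t ⟩
  t x + sum (removeAt t x)      ≡⟨ cong₂ _+_ (cong (f x *_) (⟦⟧≡1 (P? x) Px)) (sum-cong-≗ t-off-x) ⟩
  f x * 1 + sum {n} (λ _ → 0)   ≡⟨ cong₂ _+_ (*-identityʳ (f x)) (sum-replicate-zero n) ⟩
  f x + 0                       ≡⟨ +-identityʳ (f x) ⟩
  f x                           ∎
  where
    open ≡-Reasoning
    t : Fin (suc n) → ℕ
    t c = f c * ⟦ P? c ⟧
    t-off-x : ∀ j → t (punchIn x j) ≡ 0
    t-off-x j = trans (cong (f _ *_) (⟦⟧≡0 (P? _) (punchInᵢ≢i x j ∘ unique))) (*-zeroʳ (f (punchIn x j)))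

sumFin²≡∑∑ : ∀ {n} (f g : Fin n → Fin n → ℕ) → (∀ a b → f a b ≡ g a b) →
             sumFin (λ a → sumFin (f a)) ≡ ∑[ a < n ] ∑[ b < n ] g a b
sumFin²≡∑∑ f g f≗g = trans (sumFin≡sum (λ a → sumFin (f a)))
  (sum-cong-≗ λ a → trans (sumFin≡sum (f a)) (sum-cong-≗ (f≗g a)))

𝟙 : ∀ {n} → Subset n → Fin n → ℕ
𝟙 S a = ⟦ a ∈? S ⟧

𝟙-∷-suc : ∀ {n} s (S : Subset n) c → 𝟙 (s ∷ S) (suc c) ≡ 𝟙 S c
𝟙-∷-suc s S c = ⟦⟧-cong (mk⇔ drop-there there) _ _

∑𝟙≡∣∣ : ∀ {n} (S : Subset n) → ∑[ c < n ] 𝟙 S c ≡ ∣ S ∣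
∑𝟙≡∣∣ []            = refl
∑𝟙≡∣∣ (inside  ∷ S) = cong suc (trans (sum-cong-≗ (𝟙-∷-suc inside S)) (∑𝟙≡∣∣ S))
∑𝟙≡∣∣ (outside ∷ S) = trans (sum-cong-≗ (𝟙-∷-suc outside S)) (∑𝟙≡∣∣ S)

𝟙-injective : ∀ {n} {S T : Subset n} → (∀ x → 𝟙 S x ≡ 𝟙 T x) → S ≡ T
𝟙-injective {S = S} {T} 𝟙S≗𝟙T =
  ⊆-antisym (λ {x} → ⟦⟧≡⟦⟧⇒ (x ∈? S) (x ∈? T) (𝟙S≗𝟙T x))
            (λ {x} → ⟦⟧≡⟦⟧⇒ (x ∈? T) (x ∈? S) (sym (𝟙S≗𝟙T x)))

1≤∣S∣⇒Nonempty : ∀ {n} (S : Subset n) → 1 ≤ ∣ S ∣ → Nonempty S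
1≤∣S∣⇒Nonempty {n} S 1≤∣S∣ with nonempty? S
... | yes S≠∅ = S≠∅
... | no  S=∅ = contradiction (subst (1 ≤_) ∣S∣≡0 1≤∣S∣) λ ()
  where
    ∣S∣≡0 : ∣ S ∣ ≡ 0
    ∣S∣≡0 = trans (cong ∣_∣ (Empty-unique S=∅)) (∣⊥∣≡0 n)

module GroupDivision {a ℓ} (G : Group a ℓ) where
  open Group G renaming (sym to ≈-sym; trans to ≈-trans)
  open GroupProperties G using (⁻¹-anti-homo-//; ⁻¹-involutive; ⁻¹-injective; ε⁻¹≈ε)

  x∙y⁻¹≈g⇔y∙x⁻¹≈g⁻¹ : ∀ {x y g} → x ∙ y ⁻¹ ≈ g ⇔ y ∙ x ⁻¹ ≈ g ⁻¹
  x∙y⁻¹≈g⇔y∙x⁻¹≈g⁻¹ {x} {y} {g} = mk⇔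
    (λ x∙y⁻¹≈g → ≈-trans (≈-sym (⁻¹-anti-homo-// x y)) (⁻¹-cong x∙y⁻¹≈g))
    (λ y∙x⁻¹≈g⁻¹ → ≈-trans (≈-sym (⁻¹-anti-homo-// y x)) (≈-trans (⁻¹-cong y∙x⁻¹≈g⁻¹) (⁻¹-involutive g)))

  x⁻¹≈ε⇔x≈ε : ∀ {x} → x ⁻¹ ≈ ε ⇔ x ≈ ε
  x⁻¹≈ε⇔x≈ε = mk⇔
    (λ x⁻¹≈ε → ⁻¹-injective (≈-trans x⁻¹≈ε (≈-sym ε⁻¹≈ε)))
    (λ x≈ε → ≈-trans (⁻¹-cong x≈ε) ε⁻¹≈ε)

module AbelianGroupDivision {a ℓ} (G : AbelianGroup a ℓ) where
  open AbelianGroup G hiding (refl; sym; trans)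
  open GroupProperties group using (//-rightDividesˡ; //-rightDividesʳ)
  open CommutativeSemigroupProperties commutativeSemigroup using (xy∙z≈xz∙y)
  open import Relation.Binary.Reasoning.Setoid setoid

  u∙v⁻¹≈w∙z⁻¹⇔u∙z≈w∙v : ∀ {u v w z} → u ∙ v ⁻¹ ≈ w ∙ z ⁻¹ ⇔ u ∙ z ≈ w ∙ v
  u∙v⁻¹≈w∙z⁻¹⇔u∙z≈w∙v {u} {v} {w} {z} = mk⇔
    (λ eq → begin
      u ∙ z                  ≈⟨ ∙-congʳ (//-rightDividesˡ v u) ⟨
      u ∙ v ⁻¹ ∙ v ∙ z       ≈⟨ ∙-congʳ (∙-congʳ eq) ⟩
      w ∙ z ⁻¹ ∙ v ∙ z       ≈⟨ xy∙z≈xz∙y (w ∙ z ⁻¹) v z ⟩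
      w ∙ z ⁻¹ ∙ z ∙ v       ≈⟨ ∙-congʳ (//-rightDividesˡ z w) ⟩
      w ∙ v                  ∎)
    (λ eq → begin
      u ∙ v ⁻¹               ≈⟨ ∙-congʳ (//-rightDividesʳ z u) ⟨
      u ∙ z ∙ z ⁻¹ ∙ v ⁻¹    ≈⟨ ∙-congʳ (∙-congʳ eq) ⟩
      w ∙ v ∙ z ⁻¹ ∙ v ⁻¹    ≈⟨ xy∙z≈xz∙y (w ∙ v) (z ⁻¹) (v ⁻¹) ⟩
      w ∙ v ∙ v ⁻¹ ∙ z ⁻¹    ≈⟨ ∙-congʳ (//-rightDividesʳ v w) ⟩
      w ∙ z ⁻¹               ∎)

module Differences {c ℓ n} (G : FiniteAbelianGroup c ℓ n) where
  open FiniteAbelianGroup G renaming (refl to ≈-refl; sym to ≈-sym; trans to ≈-trans)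
  open GroupDivision group
  open AbelianGroupDivision abGroup
  open GroupProperties group using (x∙y⁻¹≈ε⇒x≈y; x≈y⇒x∙y⁻¹≈ε)
  open ≡-Reasoning

  δ : Carrier → Carrier → ℕ
  δ u v = ⟦ u ≈? v ⟧

  Δterm : Subset n → Subset n → Carrier → Fin n → Fin n → ℕ
  Δterm S T g a b = 𝟙 S a * (𝟙 T b * δ (enum a ∙ enum b ⁻¹) g)

  Δcount≡∑∑ : ∀ S T g → Δcount G S T g ≡ ∑[ a < n ] ∑[ b < n ] Δterm S T g a b
  Δcount≡∑∑ S T g = sumFin²≡∑∑ _ (Δterm S T g) λ a b →
    trans (⟦×-dec⟧ (a ∈? S) _) (cong (𝟙 S a *_) (⟦×-dec⟧ (b ∈? T) _))

  *-Δcount : ∀ k S T g → k * Δcount G S T g ≡ ∑[ a < n ] ∑[ b < n ] (k * Δterm S T g a b)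
  *-Δcount k S T g = begin
    k * Δcount G S T g                                 ≡⟨ cong (k *_) (Δcount≡∑∑ S T g) ⟩
    k * ∑[ a < n ] ∑[ b < n ] Δterm S T g a b          ≡⟨ *-distribˡ-sum k (λ a → ∑[ b < n ] Δterm S T g a b) ⟩
    ∑[ a < n ] (k * ∑[ b < n ] Δterm S T g a b)        ≡⟨ sum-cong-≗ (λ a → *-distribˡ-sum k (Δterm S T g a)) ⟩
    ∑[ a < n ] ∑[ b < n ] (k * Δterm S T g a b)        ∎

  Δcount-swap : ∀ S T g → Δcount G S T g ≡ Δcount G T S (g ⁻¹)
  Δcount-swap S T g = begin
    Δcount G S T g                                    ≡⟨ Δcount≡∑∑ S T g ⟩
    ∑[ a < n ] ∑[ b < n ] Δterm S T g a b             ≡⟨ ∑-comm (Δterm S T g) ⟩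
    ∑[ b < n ] ∑[ a < n ] Δterm S T g a b             ≡⟨ sum-cong-≗ (λ b → sum-cong-≗ (λ a → swap a b)) ⟩
    ∑[ b < n ] ∑[ a < n ] Δterm T S (g ⁻¹) b a        ≡⟨ Δcount≡∑∑ T S (g ⁻¹) ⟨
    Δcount G T S (g ⁻¹)                               ∎
    where
      swap : ∀ a b → Δterm S T g a b ≡ Δterm T S (g ⁻¹) b a
      swap a b = trans (x∙yz≈y∙xz (𝟙 S a) (𝟙 T b) _)
        (cong (λ t → 𝟙 T b * (𝟙 S a * t)) (⟦⟧-cong x∙y⁻¹≈g⇔y∙x⁻¹≈g⁻¹ _ _))

  -- Both sides count the triples (c, b, a) ∈ R × Y × Q with c b⁻¹ a = x: these are the
  -- coefficients of x in (R Y⁽⁻¹⁾) Q and in R (Y Q⁽⁻¹⁾)⁽⁻¹⁾ = R Q Y⁽⁻¹⁾.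
  Δcount-assoc : ∀ R Y Q x →
    ∑[ a < n ] (𝟙 Q a * Δcount G R Y (enum x ∙ enum a ⁻¹)) ≡
    ∑[ c < n ] (𝟙 R c * Δcount G Y Q (enum c ∙ enum x ⁻¹))
  Δcount-assoc R Y Q x = begin
    ∑[ a < n ] (𝟙 Q a * Δcount G R Y (x/ a))
      ≡⟨ sum-cong-≗ (λ a → *-Δcount (𝟙 Q a) R Y (x/ a)) ⟩
    ∑[ a < n ] ∑[ c < n ] ∑[ b < n ] (𝟙 Q a * Δterm R Y (x/ a) c b)
      ≡⟨ ∑-comm (λ a c → ∑[ b < n ] (𝟙 Q a * Δterm R Y (x/ a) c b)) ⟩
    ∑[ c < n ] ∑[ a < n ] ∑[ b < n ] (𝟙 Q a * Δterm R Y (x/ a) c b)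
      ≡⟨ sum-cong-≗ (λ c → ∑-comm (λ a b → 𝟙 Q a * Δterm R Y (x/ a) c b)) ⟩
    ∑[ c < n ] ∑[ b < n ] ∑[ a < n ] (𝟙 Q a * Δterm R Y (x/ a) c b)
      ≡⟨ sum-cong-≗ (λ c → sum-cong-≗ (λ b → sum-cong-≗ (λ a → regroup c b a))) ⟩
    ∑[ c < n ] ∑[ b < n ] ∑[ a < n ] (𝟙 R c * Δterm Y Q (/x c) b a)
      ≡⟨ sum-cong-≗ (λ c → *-Δcount (𝟙 R c) Y Q (/x c)) ⟨
    ∑[ c < n ] (𝟙 R c * Δcount G Y Q (/x c))
      ∎
    where
      x/ /x : Fin n → Carrier
      x/ a = enum x ∙ enum a ⁻¹
      /x c = enum c ∙ enum x ⁻¹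
      same-triple : ∀ {c b a} → enum c ∙ enum b ⁻¹ ≈ x/ a ⇔ enum b ∙ enum a ⁻¹ ≈ /x c
      same-triple = mk⇔
        (λ eq → from u∙v⁻¹≈w∙z⁻¹⇔u∙z≈w∙v (≈-trans (comm _ _) (≈-sym (to u∙v⁻¹≈w∙z⁻¹⇔u∙z≈w∙v eq))))
        (λ eq → from u∙v⁻¹≈w∙z⁻¹⇔u∙z≈w∙v (≈-trans (≈-sym (to u∙v⁻¹≈w∙z⁻¹⇔u∙z≈w∙v eq)) (comm _ _)))
      regroup : ∀ c b a → 𝟙 Q a * Δterm R Y (x/ a) c b ≡ 𝟙 R c * Δterm Y Q (/x c) b a
      regroup c b a = trans (x∙yz≈y∙xz (𝟙 Q a) (𝟙 R c) _) (cong (𝟙 R c *_)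
        (trans (x∙yz≈y∙xz (𝟙 Q a) (𝟙 Y b) _)
          (cong (λ t → 𝟙 Y b * (𝟙 Q a * t)) (⟦⟧-cong same-triple _ _))))

  -- The coefficient function of λ(G − 1_G) ∈ ℤ[G].
  scaled[G−1] : ℕ → Carrier → ℕ
  scaled[G−1] lam g = lam * ⟦ ¬? (g ≈? ε) ⟧

  scaled[G−1]-⁻¹ : ∀ lam g → scaled[G−1] lam (g ⁻¹) ≡ scaled[G−1] lam g
  scaled[G−1]-⁻¹ lam g = cong (lam *_) (⟦⟧-cong
    (mk⇔ (λ g⁻¹≉ε g≈ε → g⁻¹≉ε (from x⁻¹≈ε⇔x≈ε g≈ε)) (λ g≉ε g⁻¹≈ε → g≉ε (to x⁻¹≈ε⇔x≈ε g⁻¹≈ε))) _ _)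

  ∑𝟙*scaled[G−1] : ∀ lam R x →
    ∑[ c < n ] (𝟙 R c * scaled[G−1] lam (enum c ∙ enum x ⁻¹)) + lam * 𝟙 R x ≡ lam * ∣ R ∣
  ∑𝟙*scaled[G−1] lam R x = begin
    ∑[ c < n ] (𝟙 R c * (lam * ⟦ ¬? (d c) ⟧)) + lam * 𝟙 R x
      ≡⟨ cong (∑[ c < n ] (𝟙 R c * (lam * ⟦ ¬? (d c) ⟧)) +_) (∑-single d (λ c → lam * 𝟙 R c) (x≈y⇒x∙y⁻¹≈ε ≈-refl) unique) ⟨
    ∑[ c < n ] (𝟙 R c * (lam * ⟦ ¬? (d c) ⟧)) + ∑[ c < n ] (lam * 𝟙 R c * ⟦ d c ⟧)
      ≡⟨ ∑-distrib-+ (λ c → 𝟙 R c * (lam * ⟦ ¬? (d c) ⟧)) (λ c → lam * 𝟙 R c * ⟦ d c ⟧) ⟨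
    ∑[ c < n ] (𝟙 R c * (lam * ⟦ ¬? (d c) ⟧) + lam * 𝟙 R c * ⟦ d c ⟧)
      ≡⟨ sum-cong-≗ (λ c → split (𝟙 R c) (d c)) ⟩
    ∑[ c < n ] (lam * 𝟙 R c)
      ≡⟨ *-distribˡ-sum lam (𝟙 R) ⟨
    lam * ∑[ c < n ] 𝟙 R c
      ≡⟨ cong (lam *_) (∑𝟙≡∣∣ R) ⟩
    lam * ∣ R ∣ ∎
    where
      d : ∀ c → Dec (enum c ∙ enum x ⁻¹ ≈ ε)
      d c = (enum c ∙ enum x ⁻¹) ≈? ε
      unique : ∀ {c} → enum c ∙ enum x ⁻¹ ≈ ε → c ≡ x
      unique {c} eq = enum-inj c x (x∙y⁻¹≈ε⇒x≈y _ _ eq)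
      split : ∀ r (p? : Dec P) → r * (lam * ⟦ ¬? p? ⟧) + lam * r * ⟦ p? ⟧ ≡ lam * r
      split r p? = begin
        r * (lam * ⟦ ¬? p? ⟧) + lam * r * ⟦ p? ⟧    ≡⟨ cong (_+ lam * r * ⟦ p? ⟧) (x∙yz≈yx∙z r lam _) ⟩
        lam * r * ⟦ ¬? p? ⟧ + lam * r * ⟦ p? ⟧      ≡⟨ *-distribˡ-+ (lam * r) _ _ ⟨
        lam * r * (⟦ ¬? p? ⟧ + ⟦ p? ⟧)              ≡⟨ cong (lam * r *_) (⟦¬?⟧+⟦⟧≡1 p?) ⟩
        lam * r * 1                                 ≡⟨ *-identityʳ (lam * r) ⟩
        lam * r                                     ∎

  Δcount≡scaled[G−1]⇒≡ : ∀ {lam} .{{_ : NonZero lam}} {P Y Q} → ∣ P ∣ ≡ ∣ Q ∣ →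
    (∀ g → Δcount G P Y g ≡ scaled[G−1] lam g) →
    (∀ g → Δcount G Y Q g ≡ scaled[G−1] lam g) → P ≡ Q
  Δcount≡scaled[G−1]⇒≡ {lam} {P} {Y} {Q} ∣P∣≡∣Q∣ ΔPY ΔYQ = 𝟙-injective λ x →
    *-cancelˡ-≡ _ _ lam (+-cancelˡ-≡ (coefficient Q x) _ _ (begin
      coefficient Q x + lam * 𝟙 P x   ≡⟨ cong (_+ lam * 𝟙 P x) (coefficient-P≡Q x) ⟨
      coefficient P x + lam * 𝟙 P x   ≡⟨ coefficient+𝟙 P x ⟩
      lam * ∣ P ∣                     ≡⟨ cong (lam *_) ∣P∣≡∣Q∣ ⟩
      lam * ∣ Q ∣                     ≡⟨ coefficient+𝟙 Q x ⟨
      coefficient Q x + lam * 𝟙 Q x   ∎))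
    where
      coefficient : Subset n → Fin n → ℕ
      coefficient R x = ∑[ a < n ] (𝟙 Q a * Δcount G R Y (enum x ∙ enum a ⁻¹))
      ΔQY : ∀ g → Δcount G Q Y g ≡ scaled[G−1] lam g
      ΔQY g = trans (Δcount-swap Q Y g) (trans (ΔYQ (g ⁻¹)) (scaled[G−1]-⁻¹ lam g))
      coefficient-P≡Q : ∀ x → coefficient P x ≡ coefficient Q x
      coefficient-P≡Q x = sum-cong-≗ λ a → cong (𝟙 Q a *_) (trans (ΔPY _) (sym (ΔQY _)))
      coefficient+𝟙 : ∀ R x → coefficient R x + lam * 𝟙 R x ≡ lam * ∣ R ∣
      coefficient+𝟙 R x = trans
        (cong (_+ lam * 𝟙 R x) (trans (Δcount-assoc R Y Q x) (sum-cong-≗ λ c → cong (𝟙 R c *_) (ΔYQ _))))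
        (∑𝟙*scaled[G−1] lam R x)

  module _ {m l lam} {A : Fin m → Subset n} (scedf : Is1SCEDF G m l lam A) where
    open Is1SCEDF scedf

    Δcount-next≡scaled[G−1] : ∀ i g → Δcount G (A (next i)) (A i) g ≡ scaled[G−1] lam g
    Δcount-next≡scaled[G−1] i g with g ≈? ε
    ... | yes g≈ε = trans (diff-one i g g≈ε) (sym (*-zeroʳ lam))
    ... | no  g≉ε = trans (diff-ne i g g≉ε) (sym (*-identityʳ lam))

    A-next-next≡A : ∀ i → A (next (next i)) ≡ A i
    A-next-next≡A i = Δcount≡scaled[G−1]⇒≡ {{>-nonZero λ-pos}} (trans (size _) (sym (size i)))
      (Δcount-next≡scaled[G−1] (next i)) (Δcount-next≡scaled[G−1] i)

theorem6 : ∀ {c ℓ : Level} {n : ℕ} (G : FiniteAbelianGroup c ℓ n)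
             (m l lam : ℕ) (A : Fin m → Subset n) →
             2 ≤ l → 2 ≤ m → Is1SCEDF G m l lam A → m ≡ 2
theorem6 G 0 l lam A _ () _
theorem6 G 1 l lam A _ (s≤s ()) _
theorem6 G 2 l lam A _ _ _ = refl
theorem6 G (suc (suc (suc _))) l lam A 2≤l _ scedf =
  let x , x∈A₀ = 1≤∣S∣⇒Nonempty (A zero) 1≤∣A₀∣
      x∈A₂     = subst (x ∈_) (sym (A-next-next≡A scedf zero)) x∈A₀
  in ⊥-elim (disjoint (next (next zero)) zero (λ ()) x x∈A₂ x∈A₀)
  where
    open Is1SCEDF scedf
    open Differences G
    1≤∣A₀∣ : 1 ≤ ∣ A zero ∣
    1≤∣A₀∣ = subst (1 ≤_) (sym (size zero)) (≤-trans (s≤s z≤n) 2≤l)
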